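{- Let $N(\ell) = \min\{n \geq 0 : L(n) = \ell\}$ be the minimum number of stones in a winning Tchoukaillon board of length $\ell$. Then $N(\ell) = O(\ell^2)$; more precisely, \[ \frac{\ell^2}{4} + O(\ell) \leq N(\ell) \leq \frac{\ell^2}{2} + O(\ell) \quad (\ell \to \infty), \] i.e. there is a constant $C$ such that $\frac{\ell^2}{4} - C\ell \leq N(\ell) \leq \frac{\ell^2}{2} + C\ell$ for all $\ell \geq 1$.
   Context: Tchoukaillon boards. For each $n \geq 0$ define a sequence $b(n) = (b_1(n), b_2(n), \ldots)$ of nonnegative integers recursively: $b(0)$ is the all-zero sequence; given $b(n)$, let $p(n) = \min\{j \geq 1 : b_j(n) = 0\}$ and set $b_i(n+1) = b_i(n)$ if $i > p(n)$, $b_i(n+1) = i$ if $i = p(n)$, and $b_i(n+1) = b_i(n) - 1$ if $i < p(n)$. $b(n)$ is the unique winning Tchoukaillon board with $n$ stones. Its length is $L(n) = \min\{i \geq 0 : b_j(n) = 0 \text{ for all } j > i\}$. -}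

module Defs where

open import Data.Nat using (ℕ; zero; suc; _+_; _*_; _∸_; _<_; _≤_)
open import Data.List using (List; []; _∷_)
open import Data.Product using (_×_; ∃)
open import Relation.Binary.PropositionalEquality using (_≡_; _≢_)
open import Data.Empty using (⊥)

-- A board is represented by its list of entries (b_1, b_2, ..., b_k);
-- all entries beyond position k are 0.  Trailing zeros in the list are allowed.

-- One sowing step, starting at position i (the head of the list is b_i).
stepFrom : ℕ → List ℕ → List ℕ
stepFrom i []            = i ∷ []
stepFrom i (zero  ∷ bs)  = i ∷ bs
stepFrom i (suc x ∷ bs)  = x ∷ stepFrom (suc i) bs

step : List ℕ → List ℕ
step = stepFrom 1

board : ℕ → List ℕ
board zero    = []
board (suc n) = step (board n)

-- Value b_j of a board (1-indexed; b_j = 0 past the end, and index 0 unused).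
entry : List ℕ → ℕ → ℕ
entry []       _             = 0
entry (x ∷ bs) zero          = 0
entry (x ∷ bs) (suc zero)    = x
entry (x ∷ bs) (suc (suc j)) = entry bs (suc j)

b : ℕ → ℕ → ℕ
b n j = entry (board n) j

IsLength : ℕ → ℕ → Set
IsLength n i = (∀ j → i < j → b n j ≡ 0) × (∀ i' → i' < i → ∃ λ j → i' < j × b n j ≢ 0)

IsMinStones : ℕ → ℕ → Set
IsMinStones ℓ n = IsLength n ℓ × (∀ m → m < n → ¬L m)
  where
  ¬L : ℕ → Set
  ¬L m = IsLength m ℓ → ⊥

module Submission where

-- Every board b(n) satisfies three invariants, each preserved by a sowing step:
--   * entries are bounded by their positions, b_i ≤ i;
--   * every suffix sum b_i + b_{i+1} + … is divisible by i;
--   * the board has no trailing zeros, so its length L(n) is its list length.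
-- Moreover the total number of stones of b(n) is n, and one step lengthens a
-- board by at most one position.
-- Bounded entries give n ≤ 1 + 2 + … + L(n) = L(L+1)/2.  Divisible suffix sums
-- give, by induction from the right, that the suffix starting at position c + 1
-- (of length L - c) holds at least (c + 1)(L - c) stones; with c = ⌊L/2⌋ this
-- is about L²/4.
-- A discrete intermediate value argument (lengths start at 0, grow by at most
-- one, and reach ℓ by time ℓ(ℓ+1)/2) yields a first board of length ℓ, which is
-- N(ℓ); the two bounds at n = N(ℓ) give the theorem with C = 1.

open import Defs
open import Data.Nat using (ℕ; zero; suc; _+_; _*_; _≤_; _<_; _∸_; z≤n; s≤s; _<?_)
open import Data.Nat.Properties
open import Data.Nat.Divisibility using (_∣_; divides; _∣0; n∣n; ∣m∣n⇒∣m+n)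
open import Data.Nat.Tactic.RingSolver using (solve-∀)
open import Data.List using (List; []; _∷_; length)
open import Data.Nat.ListAction using (sum)
open import Data.Product using (Σ; ∃; ∃₂; _×_; _,_)
open import Data.Sum using (_⊎_; inj₁; inj₂)
open import Data.Unit using (⊤; tt)
open import Data.Empty using (⊥-elim)
open import Relation.Nullary using (yes; no)
open import Relation.Binary.Definitions using (tri<; tri≈; tri>)
open import Relation.Binary.PropositionalEquality

-- Sowing from position i adds exactly i stones: the target hole p receives p
-- stones while each of the p - i holes before it loses one.
sum-stepFrom : ∀ i bs → sum (stepFrom i bs) ≡ sum bs + i
sum-stepFrom i [] = +-identityʳ i
sum-stepFrom i (zero ∷ bs) = +-comm i (sum bs)
sum-stepFrom i (suc x ∷ bs) = begin
  x + sum (stepFrom (suc i) bs) ≡⟨ cong (x +_) (sum-stepFrom (suc i) bs) ⟩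
  x + (sum bs + suc i)          ≡⟨ rearrange x (sum bs) i ⟩
  suc x + sum bs + i            ∎
  where
  open ≡-Reasoning
  rearrange : ∀ x s i → x + (s + suc i) ≡ suc x + s + i
  rearrange = solve-∀

stepFrom-nonempty : ∀ i bs → stepFrom i bs ≢ []
stepFrom-nonempty i [] ()
stepFrom-nonempty i (zero ∷ bs) ()
stepFrom-nonempty i (suc x ∷ bs) ()

length-stepFrom : ∀ i bs → length (stepFrom i bs) ≤ suc (length bs)
length-stepFrom i [] = ≤-refl
length-stepFrom i (zero ∷ bs) = n≤1+n _
length-stepFrom i (suc x ∷ bs) = s≤s (length-stepFrom (suc i) bs)

Bounded : ℕ → List ℕ → Set
Bounded i [] = ⊤
Bounded i (x ∷ bs) = x ≤ i × Bounded (suc i) bs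

-- Decrements preserve the bound, and the target hole p receives exactly p stones.
bounded-stepFrom : ∀ i bs → Bounded i bs → Bounded i (stepFrom i bs)
bounded-stepFrom i [] _ = ≤-refl , tt
bounded-stepFrom i (zero ∷ bs) (_ , rest) = ≤-refl , rest
bounded-stepFrom i (suc x ∷ bs) (x<i , rest) =
  <⇒≤ x<i , bounded-stepFrom (suc i) bs rest

SuffixDivisible : ℕ → List ℕ → Set
SuffixDivisible i [] = ⊤
SuffixDivisible i (x ∷ bs) = i ∣ x + sum bs × SuffixDivisible (suc i) bs

-- A step from position i adds i stones to every suffix starting at or before
-- the target hole, and leaves later suffixes untouched.
divisible-stepFrom : ∀ i bs → SuffixDivisible i bs → SuffixDivisible i (stepFrom i bs)
divisible-stepFrom i [] _ = ∣m∣n⇒∣m+n n∣n (i ∣0) , tt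
divisible-stepFrom i (zero ∷ bs) (i∣s , rest) = ∣m∣n⇒∣m+n n∣n i∣s , rest
divisible-stepFrom i (suc x ∷ bs) (i∣s , rest) =
  subst (i ∣_) (sym (sum-stepFrom i (suc x ∷ bs))) (∣m∣n⇒∣m+n i∣s n∣n)
  , divisible-stepFrom (suc i) bs rest

NoTrailingZero : List ℕ → Set
NoTrailingZero [] = ⊤
NoTrailingZero (x ∷ bs) = (bs ≡ [] → x ≢ 0) × NoTrailingZero bs

-- A step from a positive position puts a positive entry into the target hole,
-- which becomes the last entry if it lies beyond the old list.
noTrailingZero-stepFrom : ∀ i bs → NoTrailingZero bs → NoTrailingZero (stepFrom (suc i) bs)
noTrailingZero-stepFrom i [] _ = (λ _ ()) , tt
noTrailingZero-stepFrom i (zero ∷ bs) (_ , rest) = (λ _ ()) , rest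
noTrailingZero-stepFrom i (suc x ∷ bs) (_ , rest) =
  (λ empty → ⊥-elim (stepFrom-nonempty (suc (suc i)) bs empty))
  , noTrailingZero-stepFrom (suc i) bs rest

board-invariant : (P : List ℕ → Set) → P [] → (∀ bs → P bs → P (step bs)) → ∀ n → P (board n)
board-invariant P P[] P-step zero = P[]
board-invariant P P[] P-step (suc n) = P-step (board n) (board-invariant P P[] P-step n)

board-bounded : ∀ n → Bounded 1 (board n)
board-bounded = board-invariant (Bounded 1) tt (bounded-stepFrom 1)

board-divisible : ∀ n → SuffixDivisible 1 (board n)
board-divisible = board-invariant (SuffixDivisible 1) tt (divisible-stepFrom 1)

board-noTrailingZero : ∀ n → NoTrailingZero (board n)
board-noTrailingZero = board-invariant NoTrailingZero tt (noTrailingZero-stepFrom 0)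

sum-board : ∀ n → sum (board n) ≡ n
sum-board zero = refl
sum-board (suc n) = trans (sum-stepFrom 1 (board n)) (trans (+-comm _ 1) (cong suc (sum-board n)))

entry-beyond : ∀ bs j → length bs < j → entry bs j ≡ 0
entry-beyond [] j _ = refl
entry-beyond (x ∷ bs) (suc (suc j)) (s≤s len<j) = entry-beyond bs (suc j) len<j

entry-last : ∀ x bs → NoTrailingZero (x ∷ bs) → entry (x ∷ bs) (suc (length bs)) ≢ 0
entry-last x [] (x≢0 , _) = x≢0 refl
entry-last x (y ∷ bs) (_ , rest) = entry-last y bs rest

isLength-board : ∀ n → IsLength n (length (board n))
isLength-board n = entry-beyond (board n) , nonzero-after (board n) (board-noTrailingZero n)
  where
  nonzero-after : ∀ bs → NoTrailingZero bs → ∀ i → i < length bs → ∃ λ j → i < j × entry bs j ≢ 0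
  nonzero-after (x ∷ bs) ntz i i<len = suc (length bs) , i<len , entry-last x bs ntz

isLength-unique : ∀ n {a c} → IsLength n a → IsLength n c → a ≡ c
isLength-unique n {a} {c} (zero-after-a , nonzero-below-a) (zero-after-c , nonzero-below-c)
  with <-cmp a c
... | tri≈ _ a≡c _ = a≡c
... | tri< a<c _ _ = let (j , a<j , bj≢0) = nonzero-below-c a a<c in ⊥-elim (bj≢0 (zero-after-a j a<j))
... | tri> _ _ c<a = let (j , c<j , bj≢0) = nonzero-below-a c c<a in ⊥-elim (bj≢0 (zero-after-c j c<j))

triangle : ℕ → ℕ
triangle zero = 0
triangle (suc k) = suc k + triangle k

triangle-closed : ∀ k → 2 * triangle k ≡ k * k + k
triangle-closed zero = refl
triangle-closed (suc k) = begin
  2 * (suc k + triangle k)         ≡⟨ *-distribˡ-+ 2 (suc k) (triangle k) ⟩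
  2 * suc k + 2 * triangle k       ≡⟨ cong (2 * suc k +_) (triangle-closed k) ⟩
  2 * suc k + (k * k + k)          ≡⟨ expand k ⟩
  suc k * suc k + suc k            ∎
  where
  open ≡-Reasoning
  expand : ∀ k → 2 * suc k + (k * k + k) ≡ suc k * suc k + suc k
  expand = solve-∀

triangle-< : ∀ {a c} → a < c → triangle a < triangle c
triangle-< {a} {suc c} (s≤s a≤c) = s≤s (≤-trans (triangle-mono a≤c) (m≤n+m (triangle c) c))
  where
  triangle-mono : ∀ {a c} → a ≤ c → triangle a ≤ triangle c
  triangle-mono z≤n = z≤n
  triangle-mono (s≤s p) = +-mono-≤ (s≤s p) (triangle-mono p)

sum-bounded : ∀ a bs → Bounded (suc a) bs → sum bs + triangle a ≤ triangle (a + length bs)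
sum-bounded a [] _ = ≤-reflexive (cong triangle (sym (+-identityʳ a)))
sum-bounded a (x ∷ bs) (x≤a+1 , rest) = begin
  x + sum bs + triangle a      ≡⟨ cong (_+ triangle a) (+-comm x (sum bs)) ⟩
  sum bs + x + triangle a      ≡⟨ +-assoc (sum bs) x (triangle a) ⟩
  sum bs + (x + triangle a)    ≤⟨ +-monoʳ-≤ (sum bs) (+-monoˡ-≤ (triangle a) x≤a+1) ⟩
  sum bs + triangle (suc a)    ≤⟨ sum-bounded (suc a) bs rest ⟩
  triangle (suc a + length bs) ≡⟨ cong triangle (sym (+-suc a (length bs))) ⟩
  triangle (a + suc (length bs)) ∎
  where open ≤-Reasoning

stones≤triangle : ∀ n → n ≤ triangle (length (board n))
stones≤triangle n = subst (_≤ triangle (length (board n))) (trans (+-identityʳ _) (sum-board n))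
  (sum-bounded 0 (board n) (board-bounded n))

sum-positive : ∀ x bs → NoTrailingZero (x ∷ bs) → 0 < x + sum bs
sum-positive x [] (x≢0 , _) = subst (0 <_) (sym (+-identityʳ x)) (n≢0⇒n>0 (x≢0 refl))
sum-positive x (y ∷ bs) (_ , rest) = ≤-trans (sum-positive y bs rest) (m≤n+m _ x)

next-multiple : ∀ d k s → suc d ∣ s → suc d * k < s → suc d * suc k ≤ s
next-multiple d k s (divides q refl) dk<qd =
  ≤-trans (≤-reflexive (*-comm (suc d) (suc k))) (*-monoˡ-≤ (suc d) k<q)
  where
  k<q : suc k ≤ q
  k<q = *-cancelʳ-< (suc d) k q (subst (_< q * suc d) (*-comm (suc d) k) dk<qd)

below-larger-multiple : ∀ d k s → 0 < s → suc d * k ≤ s → d * k < s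
below-larger-multiple d zero s 0<s _ = subst (_< s) (sym (*-zeroʳ d)) 0<s
below-larger-multiple d (suc k) s _ dk≤s = <-≤-trans (*-monoˡ-< (suc k) (n<1+n d)) dk≤s

-- A list of length k starting at position a+1 with divisible suffix sums and
-- no trailing zeros holds at least (a + 1) * k stones: each suffix sum exceeds
-- the one to its right and is a multiple of its starting position.
sum-divisible : ∀ a bs → SuffixDivisible (suc a) bs → NoTrailingZero bs →
  suc a * length bs ≤ sum bs
sum-divisible a [] _ _ = ≤-reflexive (*-zeroʳ (suc a))
sum-divisible a (x ∷ bs) (a+1∣s , rest) ntz@(_ , ntz-rest) =
  next-multiple a (length bs) (x + sum bs) a+1∣s
    (below-larger-multiple (suc a) (length bs) (x + sum bs) (sum-positive x bs ntz)
      (≤-trans (sum-divisible (suc a) bs rest ntz-rest) (m≤n+m (sum bs) x)))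

-- Dropping the first c entries: the rest starts at position a + 1 + c.
sum-divisible-suffix : ∀ a bs → SuffixDivisible (suc a) bs → NoTrailingZero bs →
  ∀ c → (suc a + c) * (length bs ∸ c) ≤ sum bs
sum-divisible-suffix a bs div ntz zero =
  subst (λ p → p * length bs ≤ sum bs) (sym (+-identityʳ (suc a))) (sum-divisible a bs div ntz)
sum-divisible-suffix a [] _ _ (suc c) = ≤-reflexive (*-zeroʳ (suc a + suc c))
sum-divisible-suffix a (x ∷ bs) (_ , div) (_ , ntz) (suc c) = begin
  (suc a + suc c) * (length bs ∸ c)   ≡⟨ cong (_* (length bs ∸ c)) (+-suc (suc a) c) ⟩
  (suc (suc a) + c) * (length bs ∸ c) ≤⟨ sum-divisible-suffix (suc a) bs div ntz c ⟩
  sum bs                              ≤⟨ m≤n+m (sum bs) x ⟩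
  x + sum bs                          ∎
  where open ≤-Reasoning

rectangle≤stones : ∀ n c → (1 + c) * (length (board n) ∸ c) ≤ n
rectangle≤stones n c = subst ((1 + c) * (length (board n) ∸ c) ≤_) (sum-board n)
  (sum-divisible-suffix 0 (board n)
    (board-divisible n) (board-noTrailingZero n) c)

halves : ∀ ℓ → ∃₂ λ h h' → (h' ≡ h ⊎ h' ≡ suc h) × h + h' ≡ ℓ
halves zero = 0 , 0 , inj₁ refl , refl
halves (suc ℓ) with halves ℓ
... | h , .h , inj₁ refl , h+h≡ℓ = h , suc h , inj₂ refl , trans (+-suc h h) (cong suc h+h≡ℓ)
... | h , .(suc h) , inj₂ refl , h+h'≡ℓ = suc h , suc h , inj₁ refl , cong suc h+h'≡ℓ

square≤rectangle : ∀ h h' → h' ≡ h ⊎ h' ≡ suc h →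
  (h + h') * (h + h') ≤ 4 * ((1 + h) * h') + 4 * (h + h')
square≤rectangle h .h (inj₁ refl) = subst ((h + h) * (h + h) ≤_) (sym (even h)) (m≤m+n _ (12 * h))
  where
  even : ∀ h → 4 * ((1 + h) * h) + 4 * (h + h) ≡ (h + h) * (h + h) + 12 * h
  even = solve-∀
square≤rectangle h .(suc h) (inj₂ refl) = subst ((h + suc h) * (h + suc h) ≤_) (sym (odd h)) (m≤m+n _ (12 * h + 7))
  where
  odd : ∀ h → 4 * ((1 + h) * suc h) + 4 * (h + suc h) ≡ (h + suc h) * (h + suc h) + (12 * h + 7)
  odd = solve-∀

FirstHit : (ℕ → ℕ) → ℕ → ℕ → Set
FirstHit f ℓ n = f n ≡ ℓ × (∀ m → m < n → f m < ℓ)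

module _ (f : ℕ → ℕ) (ℓ : ℕ) (slow : ∀ n → f (suc n) ≤ suc (f n)) (start : f 0 < ℓ) where

  belowOrHit : ∀ M → (∀ m → m ≤ M → f m < ℓ) ⊎ ∃ (FirstHit f ℓ)
  belowOrHit zero = inj₁ λ { .zero z≤n → start }
  belowOrHit (suc M) with belowOrHit M
  ... | inj₂ hit = inj₂ hit
  ... | inj₁ below with f (suc M) <? ℓ
  ...   | yes now-below = inj₁ λ m m≤1+M → case (m≤n⇒m<n∨m≡n m≤1+M)
    where
    case : ∀ {m} → m < suc M ⊎ m ≡ suc M → f m < ℓ
    case (inj₁ (s≤s m≤M)) = below _ m≤M
    case (inj₂ refl) = now-below
  ...   | no not-below = inj₂ (suc M , hits , λ { m (s≤s m≤M) → below m m≤M })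
    where
    hits : f (suc M) ≡ ℓ
    hits = ≤-antisym (≤-trans (slow M) (below M ≤-refl)) (≮⇒≥ not-below)

  firstHit : ∀ M → ℓ ≤ f M → ∃ (FirstHit f ℓ)
  firstHit M reached with belowOrHit M
  ... | inj₁ below = ⊥-elim (<⇒≱ (below M ≤-refl) reached)
  ... | inj₂ hit = hit

lengthOf : ℕ → ℕ
lengthOf n = length (board n)

firstHit⇒isMinStones : ∀ {ℓ N} → FirstHit lengthOf ℓ N → IsMinStones ℓ N
firstHit⇒isMinStones {ℓ} {N} (L≡ℓ , earlier) =
  subst (IsLength N) L≡ℓ (isLength-board N) ,
  λ m m<N isLen → <-irrefl (isLength-unique m (isLength-board m) isLen) (earlier m m<N)

length-reaches : ∀ ℓ → ℓ ≤ lengthOf (triangle ℓ)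
length-reaches ℓ = ≮⇒≥ λ L<ℓ → <⇒≱ (triangle-< L<ℓ) (stones≤triangle (triangle ℓ))

-- With C = 1: N(ℓ) is the first hit of ℓ by L, and the two board bounds at
-- n = N(ℓ), with c = ⌊ℓ/2⌋ for the lower one, give the inequalities.
theorem3p6 : ∃ λ (C : ℕ) → ∀ (ℓ : ℕ) → 1 ≤ ℓ →
    Σ ℕ λ N → IsMinStones ℓ N
      × (ℓ * ℓ ≤ 4 * N + 4 * C * ℓ)
      × (2 * N ≤ ℓ * ℓ + 2 * C * ℓ)
theorem3p6 = 1 , bounds
  where
  bounds : ∀ ℓ → 1 ≤ ℓ → Σ ℕ λ N → IsMinStones ℓ N
    × (ℓ * ℓ ≤ 4 * N + 4 * ℓ) × (2 * N ≤ ℓ * ℓ + 2 * ℓ)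
  bounds ℓ 1≤ℓ with firstHit lengthOf ℓ (λ n → length-stepFrom 1 (board n)) 1≤ℓ
                      (triangle ℓ) (length-reaches ℓ)
  ... | N , hit@(L≡ℓ , _) = N , firstHit⇒isMinStones hit , lower , upper
    where
    upper : 2 * N ≤ ℓ * ℓ + 2 * ℓ
    upper = ≤-trans (*-monoʳ-≤ 2 (subst (λ L → N ≤ triangle L) L≡ℓ (stones≤triangle N)))
      (≤-trans (≤-reflexive (triangle-closed ℓ)) (+-monoʳ-≤ (ℓ * ℓ) (m≤m+n ℓ _)))
    lower : ℓ * ℓ ≤ 4 * N + 4 * ℓ
    lower with halves ℓ
    ... | h , h' , balanced , refl = ≤-trans (square≤rectangle h h' balanced)
      (+-monoˡ-≤ (4 * (h + h')) (*-monoʳ-≤ 4 rectangle))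
      where
      rectangle : (1 + h) * h' ≤ N
      rectangle = subst (λ k → (1 + h) * k ≤ N) (trans (cong (_∸ h) L≡ℓ) (m+n∸m≡n h h'))
        (rectangle≤stones N h)
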